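{- Let $p\equiv1\pmod 4$ be a prime. Then $$\sum_{k=0}^{p-1}\left(\frac k3\right)\frac{\binom{2k}k^2}{(-16)^k}\equiv0\pmod{p^2}.$$
   Context: $\left(\frac k3\right)$ is the Legendre symbol modulo $3$. Congruences between rationals with denominators prime to $p$ are understood in the ring of such rationals. -}

module Defs where

open import Data.Nat as ℕ using (ℕ; zero; suc; _%_; _^_)
open import Data.Nat.Properties using (m^n≢0)
open import Data.Nat.Combinatorics using (_C_)
open import Data.Nat.Coprimality using (Coprime)
open import Data.Integer as ℤ using (ℤ; +_; -[1+_])
open import Data.Rational as ℚ using (ℚ; 0ℚ; _/_; _+_; _*_)
open import Data.Product using (Σ; _×_)
open import Relation.Binary.PropositionalEquality using (_≡_)

legendre3 : ℕ → ℤ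
legendre3 k with k % 3
... | 0 = + 0
... | 1 = + 1
... | _ = -[1+ 0 ]

negOnePow : ℕ → ℤ
negOnePow zero = + 1
negOnePow (suc k) = ℤ.- negOnePow k

16^k-nonZero : (k : ℕ) → ℕ.NonZero (16 ^ k)
16^k-nonZero k = m^n≢0 16 k

summand : ℕ → ℚ
summand k = _/_ (legendre3 k ℤ.* negOnePow k ℤ.* (+ ((2 ℕ.* k) C k)) ℤ.* (+ ((2 ℕ.* k) C k)))
                (16 ^ k) {{16^k-nonZero k}}

sumTo : ℕ → (ℕ → ℚ) → ℚ
sumTo zero f = 0ℚ
sumTo (suc n) f = sumTo n f + f n

-- x ≡ 0 (mod m) in the ring Z_(p) of rationals with denominator prime to p:
-- x = m * y for some rational y whose denominator is coprime to p.
≡0-mod-in-ℤ₍_₎ : ℕ → ℚ → ℕ → Set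
≡0-mod-in-ℤ₍ p ₎ x m = Σ ℚ λ y → Coprime (ℚ.denominatorℕ y) p × (x ≡ (+ m / 1) * y)

-- Write p = 2n + 1; n is even as p ≡ 1 (mod 4). Since binom(2k,k)/4^k = ∏_{j<k} (2j+1)/(2j+2), the k-th
-- summand is (k/3)(−1)^k ∏_{j<k} (2j+1)²/(2j+2)², while (−1)^k binom(n,k) binom(n+k,k) = ∏_{j<k} ((2j+1)² − p²)/(2j+2)².
-- The two products differ by p² times a rational whose denominator ∏_{j<k} (2j+2)² is prime to p for k < p, so
-- the sum is ≡ Σ_k (k/3) binom(n,k) binom(n+k,k) (mod p²), and this sum is exactly 0: by Vandermonde it is
-- Σ_k binom(n,k) Σ_m (m/3) binom(n,m) binom(m,k), the inner sum equals binom(n,k) (−1)^(n+k) ((2n+2k)/3), and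
-- for even n the resulting terms change sign under k ↦ n − k.
module Submission where

open import Defs
open import Data.Nat using (ℕ; _∸_; _%_; _^_)
open import Data.Nat.Primality using (Prime)
open import Relation.Binary.PropositionalEquality using (_≡_)

open import Data.Nat as ℕ using (zero; suc; _<_; _≤_; s≤s; NonZero)
import Data.Nat.Properties as ℕP
open import Data.Nat.Combinatorics using (_C_; nCk+nC[k+1]≡[n+1]C[k+1]; k>n⇒nCk≡0; nCk≡nC[n∸k]; nC1≡n)
open import Data.Nat.DivMod using ([m+n]%n≡m%n; [m+kn]%n≡m%n; m≡m%n+[m/n]*n)
open import Data.Nat.Divisibility using (_∣_; divides; ∣-trans; ∣1⇒≡1; ∣⇒≤)
open import Data.Nat.Primality using (euclidsLemma; prime⇒irreducible; prime⇒nonTrivial)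
open import Data.Nat.Coprimality using (Coprime)
import Data.Nat.GCD as ℕGCD
import Data.Nat.Tactic.RingSolver as ℕ-Solver
open import Data.Integer as ℤ using (ℤ; +_; _+_; _*_; _-_; -_)
import Data.Integer.Properties as ℤP
open import Data.Integer.Tactic.RingSolver using (solve-∀)
open import Data.Rational as ℚ using (ℚ; 0ℚ; _/_; toℚᵘ)
import Data.Rational.Properties as ℚP
open import Data.Rational.Solver using (module +-*-Solver)
open import Data.Rational.Unnormalised as ℚᵘ using (mkℚᵘ; *≡*; _≃_)
import Data.Rational.Unnormalised.Properties as ℚᵘP
open import Data.Product using (Σ; _,_; proj₁; proj₂)
open import Data.Sum using ([_,_]; inj₁; inj₂)
open import Data.Empty using (⊥-elim)
open import Function using (_∘_; case_of_)
open import Relation.Nullary using (¬_)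
open import Relation.Binary.PropositionalEquality hiding ([_])
open ≡-Reasoning

∑ : ℕ → (ℕ → ℤ) → ℤ
∑ zero    f = + 0
∑ (suc N) f = ∑ N f + f N

∑-cong : ∀ N {f g : ℕ → ℤ} → (∀ k → k < N → f k ≡ g k) → ∑ N f ≡ ∑ N g
∑-cong zero    f≡g = refl
∑-cong (suc N) f≡g = cong₂ _+_ (∑-cong N (λ k k<N → f≡g k (ℕP.m<n⇒m<1+n k<N))) (f≡g N ℕP.≤-refl)

∑-zero : ∀ N {f : ℕ → ℤ} → (∀ k → k < N → f k ≡ + 0) → ∑ N f ≡ + 0
∑-zero zero    f≡0 = refl
∑-zero (suc N) f≡0 = cong₂ _+_ (∑-zero N (λ k k<N → f≡0 k (ℕP.m<n⇒m<1+n k<N))) (f≡0 N ℕP.≤-refl)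

∑-distrib-+ : ∀ N (f g : ℕ → ℤ) → ∑ N (λ k → f k + g k) ≡ ∑ N f + ∑ N g
∑-distrib-+ zero    f g = refl
∑-distrib-+ (suc N) f g = begin
  ∑ N (λ k → f k + g k) + (f N + g N) ≡⟨ cong (_+ (f N + g N)) (∑-distrib-+ N f g) ⟩
  ∑ N f + ∑ N g + (f N + g N)         ≡⟨ interchange (∑ N f) (∑ N g) (f N) (g N) ⟩
  ∑ N f + f N + (∑ N g + g N)         ∎
  where
    interchange : ∀ a b c d → a + b + (c + d) ≡ a + c + (b + d)
    interchange = solve-∀

*-distribˡ-∑ : ∀ N c (f : ℕ → ℤ) → c * ∑ N f ≡ ∑ N (λ k → c * f k)
*-distribˡ-∑ zero    c f = ℤP.*-zeroʳ c
*-distribˡ-∑ (suc N) c f = trans (ℤP.*-distribˡ-+ c (∑ N f) (f N)) (cong (_+ c * f N) (*-distribˡ-∑ N c f))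

neg-distrib-∑ : ∀ N (f : ℕ → ℤ) → - ∑ N f ≡ ∑ N (λ k → - f k)
neg-distrib-∑ zero    f = refl
neg-distrib-∑ (suc N) f = trans (ℤP.neg-distrib-+ (∑ N f) (f N)) (cong (_+ - f N) (neg-distrib-∑ N f))

∑-suc : ∀ N (f : ℕ → ℤ) → ∑ (suc N) f ≡ f 0 + ∑ N (λ k → f (suc k))
∑-suc zero    f = ℤP.+-comm (+ 0) (f 0)
∑-suc (suc N) f = trans (cong (_+ f (suc N)) (∑-suc N f)) (ℤP.+-assoc (f 0) _ _)

∑-comm : ∀ N M (f : ℕ → ℕ → ℤ) → ∑ N (λ i → ∑ M (λ j → f i j)) ≡ ∑ M (λ j → ∑ N (λ i → f i j))
∑-comm zero    M f = sym (∑-zero M (λ _ _ → refl))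
∑-comm (suc N) M f = begin
  ∑ N (λ i → ∑ M (f i)) + ∑ M (f N)           ≡⟨ cong (_+ ∑ M (f N)) (∑-comm N M f) ⟩
  ∑ M (λ j → ∑ N (λ i → f i j)) + ∑ M (f N)   ≡⟨ ∑-distrib-+ M (λ j → ∑ N (λ i → f i j)) (f N) ⟨
  ∑ M (λ j → ∑ (suc N) (λ i → f i j))         ∎

∑-extend : ∀ {n N} (f : ℕ → ℤ) → n ≤ N → (∀ k → n ≤ k → f k ≡ + 0) → ∑ N f ≡ ∑ n f
∑-extend {n} {N} f n≤N f≡0 = begin
  ∑ N f               ≡⟨ cong (λ M → ∑ M f) (ℕP.m∸n+n≡m n≤N) ⟨
  ∑ (N ∸ n ℕ.+ n) f   ≡⟨ extra (N ∸ n) ⟩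
  ∑ n f               ∎
  where
    extra : ∀ d → ∑ (d ℕ.+ n) f ≡ ∑ n f
    extra zero    = refl
    extra (suc d) = trans (cong₂ _+_ (extra d) (f≡0 (d ℕ.+ n) (ℕP.m≤n+m n d))) (ℤP.+-identityʳ (∑ n f))

∑-reverse : ∀ N (f : ℕ → ℤ) → ∑ N f ≡ ∑ N (λ k → f (N ∸ suc k))
∑-reverse zero    f = refl
∑-reverse (suc N) f = begin
  ∑ N f + f N                          ≡⟨ cong (_+ f N) (∑-reverse N f) ⟩
  ∑ N (λ k → f (N ∸ suc k)) + f N      ≡⟨ ℤP.+-comm _ (f N) ⟩
  f N + ∑ N (λ k → f (N ∸ suc k))      ≡⟨ ∑-suc N (λ k → f (suc N ∸ suc k)) ⟨
  ∑ (suc N) (λ k → f (suc N ∸ suc k))  ∎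

∑-antisymmetric : ∀ n (f : ℕ → ℤ) → (∀ k → k ≤ n → f (n ∸ k) ≡ - f k) → ∑ (suc n) f ≡ + 0
∑-antisymmetric n f anti = x≡-x⇒x≡0 (begin
  ∑ (suc n) f                   ≡⟨ ∑-reverse (suc n) f ⟩
  ∑ (suc n) (λ k → f (n ∸ k))   ≡⟨ ∑-cong (suc n) (λ k k<1+n → anti k (ℕP.≤-pred k<1+n)) ⟩
  ∑ (suc n) (λ k → - f k)       ≡⟨ neg-distrib-∑ (suc n) f ⟨
  - ∑ (suc n) f                 ∎)
  where
    x≡-x⇒x≡0 : ∀ {x} → x ≡ - x → x ≡ + 0
    x≡-x⇒x≡0 {+ zero}    _  = refl
    x≡-x⇒x≡0 {+ suc _}   ()
    x≡-x⇒x≡0 {ℤ.-[1+ _ ]} ()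

legendre3-cong : ∀ a b → a % 3 ≡ b % 3 → legendre3 a ≡ legendre3 b
legendre3-cong a b eq with a % 3 | b % 3 | eq
... | 0           | _ | refl = refl
... | 1           | _ | refl = refl
... | suc (suc _) | _ | refl = refl

legendre3-+3 : ∀ a → legendre3 (3 ℕ.+ a) ≡ legendre3 a
legendre3-+3 a = legendre3-cong (3 ℕ.+ a) a (trans (cong (_% 3) (ℕP.+-comm 3 a)) ([m+n]%n≡m%n a 3))

legendre3-+*3 : ∀ a t → legendre3 (a ℕ.+ t ℕ.* 3) ≡ legendre3 a
legendre3-+*3 a t = legendre3-cong (a ℕ.+ t ℕ.* 3) a ([m+kn]%n≡m%n a t 3)

legendre3-+2 : ∀ a → legendre3 (2 ℕ.+ a) ≡ - (legendre3 a + legendre3 (1 ℕ.+ a))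
legendre3-+2 0 = refl
legendre3-+2 1 = refl
legendre3-+2 2 = refl
legendre3-+2 (suc (suc (suc a))) = begin
  legendre3 (3 ℕ.+ (2 ℕ.+ a))                             ≡⟨ legendre3-+3 (2 ℕ.+ a) ⟩
  legendre3 (2 ℕ.+ a)                                     ≡⟨ legendre3-+2 a ⟩
  - (legendre3 a + legendre3 (1 ℕ.+ a))                   ≡⟨ cong₂ (λ x y → - (x + y)) (legendre3-+3 a) (legendre3-+3 (1 ℕ.+ a)) ⟨
  - (legendre3 (3 ℕ.+ a) + legendre3 (3 ℕ.+ (1 ℕ.+ a)))   ∎

legendre3-double : ∀ a → legendre3 (2 ℕ.* a) ≡ - legendre3 a
legendre3-double 0 = refl
legendre3-double 1 = refl
legendre3-double 2 = refl
legendre3-double (suc (suc (suc a))) = begin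
  legendre3 (2 ℕ.* (3 ℕ.+ a))           ≡⟨ cong legendre3 (double-+3 a) ⟩
  legendre3 (3 ℕ.+ (3 ℕ.+ 2 ℕ.* a))     ≡⟨ trans (legendre3-+3 (3 ℕ.+ 2 ℕ.* a)) (legendre3-+3 (2 ℕ.* a)) ⟩
  legendre3 (2 ℕ.* a)                   ≡⟨ legendre3-double a ⟩
  - legendre3 a                         ≡⟨ cong -_ (legendre3-+3 a) ⟨
  - legendre3 (3 ℕ.+ a)                 ∎
  where
    double-+3 : ∀ a → 2 ℕ.* (3 ℕ.+ a) ≡ 3 ℕ.+ (3 ℕ.+ 2 ℕ.* a)
    double-+3 = ℕ-Solver.solve-∀

legendre3-antisym : ∀ a b → 3 ∣ a ℕ.+ b → legendre3 b ≡ - legendre3 a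
legendre3-antisym a b (divides u a+b≡u*3) = begin
  legendre3 b                           ≡⟨ legendre3-+*3 b a ⟨
  legendre3 (b ℕ.+ a ℕ.* 3)             ≡⟨ cong legendre3 (trans (regroup a b) (cong (λ t → t ℕ.+ 2 ℕ.* a) a+b≡u*3)) ⟩
  legendre3 (u ℕ.* 3 ℕ.+ 2 ℕ.* a)       ≡⟨ cong legendre3 (ℕP.+-comm (u ℕ.* 3) (2 ℕ.* a)) ⟩
  legendre3 (2 ℕ.* a ℕ.+ u ℕ.* 3)       ≡⟨ legendre3-+*3 (2 ℕ.* a) u ⟩
  legendre3 (2 ℕ.* a)                   ≡⟨ legendre3-double a ⟩
  - legendre3 a                         ∎
  where
    regroup : ∀ a b → b ℕ.+ a ℕ.* 3 ≡ a ℕ.+ b ℕ.+ 2 ℕ.* a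
    regroup = ℕ-Solver.solve-∀

choose : ℕ → ℕ → ℤ
choose n k = + (n C k)

prev : (ℕ → ℤ) → ℕ → ℤ
prev f zero    = + 0
prev f (suc k) = f k

∑-*-prev : ∀ N (g f : ℕ → ℤ) → ∑ (suc N) (λ k → g k * prev f k) ≡ ∑ N (λ k → g (suc k) * f k)
∑-*-prev N g f = begin
  ∑ (suc N) (λ k → g k * prev f k)          ≡⟨ ∑-suc N (λ k → g k * prev f k) ⟩
  g 0 * + 0 + ∑ N (λ k → g (suc k) * f k)   ≡⟨ cong (_+ ∑ N (λ k → g (suc k) * f k)) (ℤP.*-zeroʳ (g 0)) ⟩
  + 0 + ∑ N (λ k → g (suc k) * f k)         ≡⟨ ℤP.+-identityˡ _ ⟩
  ∑ N (λ k → g (suc k) * f k)               ∎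

choose-pascal : ∀ n k → choose (suc n) (suc k) ≡ choose n k + choose n (suc k)
choose-pascal n k = trans (cong +_ (sym (nCk+nC[k+1]≡[n+1]C[k+1] n k))) (ℤP.pos-+ (n C k) (n C suc k))

choose-suc : ∀ n k → choose (suc n) k ≡ choose n k + prev (choose n) k
choose-suc n zero    = sym (ℤP.+-identityʳ (choose n 0))
choose-suc n (suc k) = trans (choose-pascal n k) (ℤP.+-comm (choose n k) (choose n (suc k)))

choose-> : ∀ {n k} → n < k → choose n k ≡ + 0
choose-> n<k = cong +_ (k>n⇒nCk≡0 n<k)

vandermonde : ∀ m n d {N} → m < N → ∑ N (λ k → choose n (k ℕ.+ d) * choose m k) ≡ choose (n ℕ.+ m) (m ℕ.+ d)
vandermonde zero n d {suc N} _ = begin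
  ∑ (suc N) (λ k → choose n (k ℕ.+ d) * choose 0 k)             ≡⟨ ∑-suc N _ ⟩
  choose n d * + 1 + ∑ N (λ k → choose n (suc k ℕ.+ d) * + 0)   ≡⟨ cong₂ _+_ (ℤP.*-identityʳ (choose n d))
                                                                         (∑-zero N (λ k _ → ℤP.*-zeroʳ (choose n (suc k ℕ.+ d)))) ⟩
  choose n d + + 0                                               ≡⟨ ℤP.+-identityʳ (choose n d) ⟩
  choose n d                                                     ≡⟨ cong (λ i → choose i d) (ℕP.+-identityʳ n) ⟨
  choose (n ℕ.+ 0) d                                             ∎
vandermonde (suc m) n d {suc N} (s≤s m<N) = begin
  ∑ (suc N) (λ k → choose n (k ℕ.+ d) * choose (suc m) k)
    ≡⟨ ∑-cong (suc N) (λ k _ → trans (cong (choose n (k ℕ.+ d) *_) (choose-suc m k))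
                                     (ℤP.*-distribˡ-+ (choose n (k ℕ.+ d)) (choose m k) (prev (choose m) k))) ⟩
  ∑ (suc N) (λ k → choose n (k ℕ.+ d) * choose m k + choose n (k ℕ.+ d) * prev (choose m) k)
    ≡⟨ ∑-distrib-+ (suc N) _ _ ⟩
  ∑ (suc N) (λ k → choose n (k ℕ.+ d) * choose m k) + ∑ (suc N) (λ k → choose n (k ℕ.+ d) * prev (choose m) k)
    ≡⟨ cong₂ _+_ (vandermonde m n d (ℕP.m<n⇒m<1+n m<N)) (∑-*-prev N (λ k → choose n (k ℕ.+ d)) (choose m)) ⟩
  choose (n ℕ.+ m) (m ℕ.+ d) + ∑ N (λ k → choose n (suc k ℕ.+ d) * choose m k)
    ≡⟨ cong (_+_ (choose (n ℕ.+ m) (m ℕ.+ d))) (∑-cong N (λ k _ → cong (λ i → choose n i * choose m k) (sym (ℕP.+-suc k d)))) ⟩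
  choose (n ℕ.+ m) (m ℕ.+ d) + ∑ N (λ k → choose n (k ℕ.+ suc d) * choose m k)
    ≡⟨ cong (_+_ (choose (n ℕ.+ m) (m ℕ.+ d))) (vandermonde m n (suc d) m<N) ⟩
  choose (n ℕ.+ m) (m ℕ.+ d) + choose (n ℕ.+ m) (m ℕ.+ suc d)
    ≡⟨ cong (λ i → choose (n ℕ.+ m) (m ℕ.+ d) + choose (n ℕ.+ m) i) (ℕP.+-suc m d) ⟩
  choose (n ℕ.+ m) (m ℕ.+ d) + choose (n ℕ.+ m) (suc (m ℕ.+ d))
    ≡⟨ choose-pascal (n ℕ.+ m) (m ℕ.+ d) ⟨
  choose (suc (n ℕ.+ m)) (suc (m ℕ.+ d))
    ≡⟨ cong (λ i → choose i (suc m ℕ.+ d)) (ℕP.+-suc n m) ⟨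
  choose (n ℕ.+ suc m) (suc m ℕ.+ d)
    ∎

vandermonde-diagonal : ∀ m n {N} → m < N → choose (n ℕ.+ m) m ≡ ∑ N (λ k → choose n k * choose m k)
vandermonde-diagonal m n {N} m<N = begin
  choose (n ℕ.+ m) m                          ≡⟨ cong (choose (n ℕ.+ m)) (ℕP.+-identityʳ m) ⟨
  choose (n ℕ.+ m) (m ℕ.+ 0)                  ≡⟨ vandermonde m n 0 m<N ⟨
  ∑ N (λ k → choose n (k ℕ.+ 0) * choose m k) ≡⟨ ∑-cong N (λ k _ → cong (λ i → choose n i * choose m k) (ℕP.+-identityʳ k)) ⟩
  ∑ N (λ k → choose n k * choose m k)         ∎

nCk-absorption : ∀ n k → suc k ℕ.* (suc n C suc k) ≡ suc n ℕ.* (n C k)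
nCk-absorption zero    zero    = refl
nCk-absorption zero    (suc k) = begin
  suc (suc k) ℕ.* (1 C suc (suc k))   ≡⟨ cong (suc (suc k) ℕ.*_) (k>n⇒nCk≡0 {n = 1} {k = suc (suc k)} (s≤s (s≤s ℕ.z≤n))) ⟩
  suc (suc k) ℕ.* 0                   ≡⟨ ℕP.*-zeroʳ (suc (suc k)) ⟩
  0                                   ≡⟨ cong (1 ℕ.*_) (k>n⇒nCk≡0 {n = 0} {k = suc k} (s≤s ℕ.z≤n)) ⟨
  1 ℕ.* (0 C suc k)                   ∎
nCk-absorption (suc n) zero    = trans (ℕP.*-identityˡ _) (trans (nC1≡n (suc (suc n))) (sym (ℕP.*-identityʳ (suc (suc n)))))
nCk-absorption (suc n) (suc k) = begin
  suc (suc k) ℕ.* (suc (suc n) C suc (suc k))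
    ≡⟨ cong (suc (suc k) ℕ.*_) (nCk+nC[k+1]≡[n+1]C[k+1] (suc n) (suc k)) ⟨
  suc (suc k) ℕ.* (suc n C suc k ℕ.+ suc n C suc (suc k))
    ≡⟨ regroup (suc k) (suc n C suc k) (suc n C suc (suc k)) ⟩
  suc n C suc k ℕ.+ (suc k ℕ.* (suc n C suc k) ℕ.+ suc (suc k) ℕ.* (suc n C suc (suc k)))
    ≡⟨ cong (suc n C suc k ℕ.+_) (cong₂ ℕ._+_ (nCk-absorption n k) (nCk-absorption n (suc k))) ⟩
  suc n C suc k ℕ.+ (suc n ℕ.* (n C k) ℕ.+ suc n ℕ.* (n C suc k))
    ≡⟨ cong (suc n C suc k ℕ.+_) (trans (sym (ℕP.*-distribˡ-+ (suc n) (n C k) (n C suc k)))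
                                         (cong (suc n ℕ.*_) (nCk+nC[k+1]≡[n+1]C[k+1] n k))) ⟩
  suc n C suc k ℕ.+ suc n ℕ.* (suc n C suc k)
    ≡⟨⟩
  suc (suc n) ℕ.* (suc n C suc k)
    ∎
  where
    regroup : ∀ k x y → suc k ℕ.* (x ℕ.+ y) ≡ x ℕ.+ (k ℕ.* x ℕ.+ suc k ℕ.* y)
    regroup = ℕ-Solver.solve-∀

choose-absorption : ∀ n k → + suc k * choose (suc n) (suc k) ≡ + suc n * choose n k
choose-absorption n k = begin
  + suc k * choose (suc n) (suc k)    ≡⟨ ℤP.pos-* (suc k) (suc n C suc k) ⟨
  + (suc k ℕ.* (suc n C suc k))       ≡⟨ cong +_ (nCk-absorption n k) ⟩
  + (suc n ℕ.* (n C k))               ≡⟨ ℤP.pos-* (suc n) (n C k) ⟩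
  + suc n * choose n k                ∎

choose-suc-ratio : ∀ n k → + suc k * choose n (suc k) ≡ (+ n - + k) * choose n k
choose-suc-ratio n k = cancel (+ k) (+ n) (choose n k) (choose n (suc k))
  (trans (cong (+ suc k *_) (sym (choose-pascal n k))) (choose-absorption n k))
  where
    cancel : ∀ K N B B′ → (+ 1 + K) * (B + B′) ≡ (+ 1 + N) * B → (+ 1 + K) * B′ ≡ (N - K) * B
    cancel K N B B′ h = begin
      (+ 1 + K) * B′                           ≡⟨ isolate K B B′ ⟩
      (+ 1 + K) * (B + B′) - (+ 1 + K) * B     ≡⟨ cong (_- (+ 1 + K) * B) h ⟩
      (+ 1 + N) * B - (+ 1 + K) * B            ≡⟨ collect K N B ⟩
      (N - K) * B                              ∎
      where
        isolate : ∀ K B B′ → (+ 1 + K) * B′ ≡ (+ 1 + K) * (B + B′) - (+ 1 + K) * B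
        isolate = solve-∀
        collect : ∀ K N B → (+ 1 + N) * B - (+ 1 + K) * B ≡ (N - K) * B
        collect = solve-∀

centralC-suc : ∀ k → suc k ℕ.* ((2 ℕ.* suc k) C suc k) ≡ 2 ℕ.* suc (2 ℕ.* k) ℕ.* ((2 ℕ.* k) C k)
centralC-suc k = begin
  suc k ℕ.* ((2 ℕ.* suc k) C suc k)       ≡⟨ cong (λ i → suc k ℕ.* (i C suc k)) (double-suc k) ⟩
  suc k ℕ.* (suc (suc m) C suc k)         ≡⟨ nCk-absorption (suc m) k ⟩
  suc (suc m) ℕ.* (suc m C k)             ≡⟨ cong (suc (suc m) ℕ.*_) symmetric ⟩
  suc (suc m) ℕ.* (suc m C suc k)         ≡⟨ regroup k (suc m C suc k) ⟩
  2 ℕ.* (suc k ℕ.* (suc m C suc k))       ≡⟨ cong (2 ℕ.*_) (nCk-absorption m k) ⟩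
  2 ℕ.* (suc m ℕ.* (m C k))               ≡⟨ ℕP.*-assoc 2 (suc m) (m C k) ⟨
  2 ℕ.* suc m ℕ.* (m C k)                 ∎
  where
    m = 2 ℕ.* k
    double-suc : ∀ k → 2 ℕ.* suc k ≡ suc (suc (2 ℕ.* k))
    double-suc = ℕ-Solver.solve-∀
    regroup : ∀ k x → suc (suc (2 ℕ.* k)) ℕ.* x ≡ 2 ℕ.* (suc k ℕ.* x)
    regroup = ℕ-Solver.solve-∀
    odd-split : ∀ k → suc (2 ℕ.* k) ≡ suc k ℕ.+ k
    odd-split = ℕ-Solver.solve-∀
    symmetric : suc m C k ≡ suc m C suc k
    symmetric = begin
      suc m C k                  ≡⟨ nCk≡nC[n∸k] (ℕP.≤-trans (ℕP.m≤n*m k 2) (ℕP.n≤1+n m)) ⟩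
      suc m C (suc m ℕ.∸ k)      ≡⟨ cong (λ i → suc m C (i ℕ.∸ k)) (odd-split k) ⟩
      suc m C (suc k ℕ.+ k ℕ.∸ k) ≡⟨ cong (suc m C_) (ℕP.m+n∸n≡m (suc k) k) ⟩
      suc m C suc k              ∎

centralChoose-suc : ∀ k → + suc k * choose (2 ℕ.* suc k) (suc k) ≡ + 2 * + suc (2 ℕ.* k) * choose (2 ℕ.* k) k
centralChoose-suc k = begin
  + suc k * choose (2 ℕ.* suc k) (suc k)                 ≡⟨ ℤP.pos-* (suc k) _ ⟨
  + (suc k ℕ.* ((2 ℕ.* suc k) C suc k))                  ≡⟨ cong +_ (centralC-suc k) ⟩
  + (2 ℕ.* suc (2 ℕ.* k) ℕ.* ((2 ℕ.* k) C k))            ≡⟨ ℤP.pos-* (2 ℕ.* suc (2 ℕ.* k)) _ ⟩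
  + (2 ℕ.* suc (2 ℕ.* k)) * choose (2 ℕ.* k) k           ≡⟨ cong (_* choose (2 ℕ.* k) k) (ℤP.pos-* 2 (suc (2 ℕ.* k))) ⟩
  + 2 * + suc (2 ℕ.* k) * choose (2 ℕ.* k) k             ∎

legendreSum : ℕ → ℕ → ℕ → ℕ → ℤ
legendreSum N n k s = ∑ N (λ m → legendre3 (m ℕ.+ s) * choose n m * choose m k)

legendreValue : ℕ → ℕ → ℕ → ℤ
legendreValue n k s = choose n k * negOnePow (n ℕ.+ k) * legendre3 (s ℕ.+ 2 ℕ.* (n ℕ.+ k))

legendreSum-suc : ∀ N n k s → legendreSum (suc N) (suc n) k s ≡
  legendreSum (suc N) n k s + (legendreSum N n k (suc s) + prev (λ j → legendreSum N n j (suc s)) k)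
legendreSum-suc N n k s = begin
  ∑ (suc N) (λ m → χ m s * choose (suc n) m * choose m k)
    ≡⟨ ∑-cong (suc N) (λ m _ → trans (cong (λ c → χ m s * c * choose m k) (choose-suc n m))
                                    (split-row (χ m s) (choose n m) (prev (choose n) m) (choose m k))) ⟩
  ∑ (suc N) (λ m → χ m s * choose n m * choose m k + χ m s * choose m k * prev (choose n) m)
    ≡⟨ ∑-distrib-+ (suc N) (λ m → χ m s * choose n m * choose m k) (λ m → χ m s * choose m k * prev (choose n) m) ⟩
  legendreSum (suc N) n k s + ∑ (suc N) (λ m → χ m s * choose m k * prev (choose n) m)
    ≡⟨ cong (_+_ (legendreSum (suc N) n k s)) (∑-*-prev N (λ m → χ m s * choose m k) (choose n)) ⟩
  legendreSum (suc N) n k s + ∑ N (λ m → χ (suc m) s * choose (suc m) k * choose n m)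
    ≡⟨ cong (_+_ (legendreSum (suc N) n k s)) (∑-cong N (λ m _ → shifted m)) ⟩
  legendreSum (suc N) n k s + ∑ N (λ m → χ m (suc s) * choose n m * choose m k + χ m (suc s) * choose n m * prev (choose m) k)
    ≡⟨ cong (_+_ (legendreSum (suc N) n k s)) (∑-distrib-+ N _ _) ⟩
  legendreSum (suc N) n k s + (legendreSum N n k (suc s) + ∑ N (λ m → χ m (suc s) * choose n m * prev (choose m) k))
    ≡⟨ cong (λ x → legendreSum (suc N) n k s + (legendreSum N n k (suc s) + x)) (lower-row k) ⟩
  legendreSum (suc N) n k s + (legendreSum N n k (suc s) + prev (λ j → legendreSum N n j (suc s)) k)
    ∎
  where
    χ : ℕ → ℕ → ℤ
    χ m s = legendre3 (m ℕ.+ s)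
    split-row : ∀ x b b′ c → x * (b + b′) * c ≡ x * b * c + x * c * b′
    split-row = solve-∀
    split-column : ∀ x c c′ b → x * (c + c′) * b ≡ x * b * c + x * b * c′
    split-column = solve-∀
    shifted : ∀ m → χ (suc m) s * choose (suc m) k * choose n m ≡
                    χ m (suc s) * choose n m * choose m k + χ m (suc s) * choose n m * prev (choose m) k
    shifted m = begin
      χ (suc m) s * choose (suc m) k * choose n m
        ≡⟨ cong₂ (λ i c → legendre3 i * c * choose n m) (sym (ℕP.+-suc m s)) (choose-suc m k) ⟩
      χ m (suc s) * (choose m k + prev (choose m) k) * choose n m
        ≡⟨ split-column (χ m (suc s)) (choose m k) (prev (choose m) k) (choose n m) ⟩
      χ m (suc s) * choose n m * choose m k + χ m (suc s) * choose n m * prev (choose m) k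
        ∎
    lower-row : ∀ k → ∑ N (λ m → χ m (suc s) * choose n m * prev (choose m) k) ≡ prev (λ j → legendreSum N n j (suc s)) k
    lower-row zero    = ∑-zero N (λ m _ → ℤP.*-zeroʳ (χ m (suc s) * choose n m))
    lower-row (suc j) = refl

legendreValue-suc : ∀ n k s → legendreValue (suc n) k s ≡
  legendreValue n k s + (legendreValue n k (suc s) + prev (λ j → legendreValue n j (suc s)) k)
legendreValue-suc n zero s = begin
  + 1 * (- E) * legendre3 (s ℕ.+ 2 ℕ.* (suc n ℕ.+ 0))
    ≡⟨ cong (λ i → + 1 * (- E) * legendre3 i) (arith s (n ℕ.+ 0)) ⟩
  + 1 * (- E) * legendre3 (2 ℕ.+ a)
    ≡⟨ cong (+ 1 * (- E) *_) (legendre3-+2 a) ⟩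
  + 1 * (- E) * - (legendre3 a + legendre3 (1 ℕ.+ a))
    ≡⟨ combine E (legendre3 a) (legendre3 (1 ℕ.+ a)) ⟩
  + 1 * E * legendre3 a + (+ 1 * E * legendre3 (1 ℕ.+ a) + + 0)
    ∎
  where
    E = negOnePow (n ℕ.+ 0)
    a = s ℕ.+ 2 ℕ.* (n ℕ.+ 0)
    arith : ∀ s m → s ℕ.+ 2 ℕ.* suc m ≡ 2 ℕ.+ (s ℕ.+ 2 ℕ.* m)
    arith = ℕ-Solver.solve-∀
    combine : ∀ E x y → + 1 * (- E) * - (x + y) ≡ + 1 * E * x + (+ 1 * E * y + + 0)
    combine = solve-∀
legendreValue-suc n (suc j) s = begin
  choose (suc n) (suc j) * - E′ * legendre3 (s ℕ.+ 2 ℕ.* (suc n ℕ.+ suc j))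
    ≡⟨ cong₃ (choose-pascal n j) (cong -_ E′≡-E) (trans (cong legendre3 (arith₄ s n j)) (legendre3-+3 (1 ℕ.+ a))) ⟩
  (B′ + B) * - - E * legendre3 (1 ℕ.+ a)
    ≡⟨ combine B B′ E (legendre3 a) (legendre3 (1 ℕ.+ a)) ⟩
  B * - E * - (legendre3 a + legendre3 (1 ℕ.+ a)) + (B * - E * legendre3 a + B′ * E * legendre3 (1 ℕ.+ a))
    ≡⟨ cong₂ (λ x y → B * - E * x + (B * - E * y + B′ * E * legendre3 (1 ℕ.+ a)))
             (legendre3-+2 a) (legendre3-+3 a) ⟨
  B * - E * legendre3 (2 ℕ.+ a) + (B * - E * legendre3 (3 ℕ.+ a) + B′ * E * legendre3 (1 ℕ.+ a))
    ≡⟨ cong₃′ (sym E′≡-E) (cong legendre3 (sym (arith₂ s n j))) (cong legendre3 (sym (arith₃ s n j))) ⟩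
  B * E′ * legendre3 (s ℕ.+ 2 ℕ.* (n ℕ.+ suc j)) + (B * E′ * legendre3 (suc s ℕ.+ 2 ℕ.* (n ℕ.+ suc j)) + B′ * E * legendre3 (1 ℕ.+ a))
    ∎
  where
    B = choose n (suc j)
    B′ = choose n j
    E = negOnePow (n ℕ.+ j)
    E′ = negOnePow (n ℕ.+ suc j)
    a = s ℕ.+ 2 ℕ.* (n ℕ.+ j)
    E′≡-E : E′ ≡ - E
    E′≡-E = cong negOnePow (ℕP.+-suc n j)
    arith₂ : ∀ s n j → s ℕ.+ 2 ℕ.* (n ℕ.+ suc j) ≡ 2 ℕ.+ (s ℕ.+ 2 ℕ.* (n ℕ.+ j))
    arith₂ = ℕ-Solver.solve-∀
    arith₃ : ∀ s n j → suc s ℕ.+ 2 ℕ.* (n ℕ.+ suc j) ≡ 3 ℕ.+ (s ℕ.+ 2 ℕ.* (n ℕ.+ j))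
    arith₃ = ℕ-Solver.solve-∀
    arith₄ : ∀ s n j → s ℕ.+ 2 ℕ.* (suc n ℕ.+ suc j) ≡ 3 ℕ.+ (1 ℕ.+ (s ℕ.+ 2 ℕ.* (n ℕ.+ j)))
    arith₄ = ℕ-Solver.solve-∀
    combine : ∀ B B′ E x y → (B′ + B) * - - E * y ≡ B * - E * - (x + y) + (B * - E * x + B′ * E * y)
    combine = solve-∀
    cong₃ : ∀ {b b′ e e′ x x′} → b ≡ b′ → e ≡ e′ → x ≡ x′ → b * e * x ≡ b′ * e′ * x′
    cong₃ refl refl refl = refl
    cong₃′ : ∀ {e e′ x x′ y y′ z} → e ≡ e′ → x ≡ x′ → y ≡ y′ → B * e * x + (B * e * y + z) ≡ B * e′ * x′ + (B * e′ * y′ + z)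
    cong₃′ refl refl refl = refl

legendreSum-value : ∀ N n k s → n < N → legendreSum N n k s ≡ legendreValue n k s
legendreSum-value (suc N) zero k s _ = begin
  ∑ (suc N) (λ m → legendre3 (m ℕ.+ s) * choose 0 m * choose m k)
    ≡⟨ ∑-suc N (λ m → legendre3 (m ℕ.+ s) * choose 0 m * choose m k) ⟩
  legendre3 s * + 1 * choose 0 k + ∑ N (λ m → legendre3 (suc m ℕ.+ s) * choose 0 (suc m) * choose (suc m) k)
    ≡⟨ cong (_+_ (legendre3 s * + 1 * choose 0 k))
            (∑-zero N (λ m _ → zero-middle (legendre3 (suc m ℕ.+ s)) (choose (suc m) k))) ⟩
  legendre3 s * + 1 * choose 0 k + + 0
    ≡⟨ base k ⟩
  legendreValue 0 k s
    ∎
  where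
    zero-middle : ∀ x y → x * + 0 * y ≡ + 0
    zero-middle = solve-∀
    base : ∀ k → legendre3 s * + 1 * choose 0 k + + 0 ≡ legendreValue 0 k s
    base zero    = trans (unit (legendre3 s)) (cong (λ i → + 1 * + 1 * legendre3 i) (sym (ℕP.+-identityʳ s)))
      where
        unit : ∀ x → x * + 1 * + 1 + + 0 ≡ + 1 * + 1 * x
        unit = solve-∀
    base (suc k) = vanish (legendre3 s) (negOnePow (suc k)) (legendre3 (s ℕ.+ 2 ℕ.* suc k))
      where
        vanish : ∀ x e y → x * + 1 * + 0 + + 0 ≡ + 0 * e * y
        vanish = solve-∀
legendreSum-value (suc N) (suc n) k s (s≤s n<N) = begin
  legendreSum (suc N) (suc n) k s
    ≡⟨ legendreSum-suc N n k s ⟩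
  legendreSum (suc N) n k s + (legendreSum N n k (suc s) + prev (λ j → legendreSum N n j (suc s)) k)
    ≡⟨ cong₂ _+_ (legendreSum-value (suc N) n k s (ℕP.m<n⇒m<1+n n<N))
                 (cong₂ _+_ (legendreSum-value N n k (suc s) n<N) (prev-cong k)) ⟩
  legendreValue n k s + (legendreValue n k (suc s) + prev (λ j → legendreValue n j (suc s)) k)
    ≡⟨ legendreValue-suc n k s ⟨
  legendreValue (suc n) k s
    ∎
  where
    prev-cong : ∀ k → prev (λ j → legendreSum N n j (suc s)) k ≡ prev (λ j → legendreValue n j (suc s)) k
    prev-cong zero    = refl
    prev-cong (suc j) = legendreSum-value N n j (suc s) n<N

negOnePow-2*+ : ∀ b a → negOnePow (2 ℕ.* b ℕ.+ a) ≡ negOnePow a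
negOnePow-2*+ zero    a = refl
negOnePow-2*+ (suc b) a = begin
  negOnePow (2 ℕ.* suc b ℕ.+ a)           ≡⟨ cong negOnePow (arith b a) ⟩
  - - negOnePow (2 ℕ.* b ℕ.+ a)           ≡⟨ ℤP.neg-involutive _ ⟩
  negOnePow (2 ℕ.* b ℕ.+ a)               ≡⟨ negOnePow-2*+ b a ⟩
  negOnePow a                             ∎
  where
    arith : ∀ b a → 2 ℕ.* suc b ℕ.+ a ≡ suc (suc (2 ℕ.* b ℕ.+ a))
    arith = ℕ-Solver.solve-∀

legendre-choose-sum≡0 : ∀ q {N} → 2 ℕ.* q < N →
  ∑ N (λ m → legendre3 m * (choose (2 ℕ.* q) m * choose (2 ℕ.* q ℕ.+ m) m)) ≡ + 0
legendre-choose-sum≡0 q {N} n<N = begin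
  ∑ N (λ m → legendre3 m * (choose n m * choose (n ℕ.+ m) m))
    ≡⟨ ∑-cong N (λ m m<N → expand m m<N) ⟩
  ∑ N (λ m → ∑ N (λ k → term k m))
    ≡⟨ ∑-comm N N (λ m k → term k m) ⟩
  ∑ N (λ k → ∑ N (term k))
    ≡⟨ ∑-cong N (λ k _ → *-distribˡ-∑ N (choose n k) (λ m → legendre3 (m ℕ.+ 0) * choose n m * choose m k)) ⟨
  ∑ N (λ k → choose n k * legendreSum N n k 0)
    ≡⟨ ∑-cong N (λ k _ → cong (choose n k *_) (legendreSum-value N n k 0 n<N)) ⟩
  ∑ N f
    ≡⟨ ∑-extend f n<N (λ k n<k → trans (cong (_* legendreValue n k 0) (choose-> n<k)) (ℤP.*-zeroˡ (legendreValue n k 0))) ⟩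
  ∑ (suc n) f
    ≡⟨ ∑-antisymmetric n f antisymmetric ⟩
  + 0
    ∎
  where
    n = 2 ℕ.* q
    term : ℕ → ℕ → ℤ
    term k m = choose n k * (legendre3 (m ℕ.+ 0) * choose n m * choose m k)
    f : ℕ → ℤ
    f k = choose n k * legendreValue n k 0
    expand : ∀ m → m < N → legendre3 m * (choose n m * choose (n ℕ.+ m) m) ≡ ∑ N (λ k → term k m)
    expand m m<N = begin
      legendre3 m * (choose n m * choose (n ℕ.+ m) m)
        ≡⟨ cong (λ c → legendre3 m * (choose n m * c)) (vandermonde-diagonal m n m<N) ⟩
      legendre3 m * (choose n m * ∑ N (λ k → choose n k * choose m k))
        ≡⟨ ℤP.*-assoc (legendre3 m) (choose n m) (∑ N (λ k → choose n k * choose m k)) ⟨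
      legendre3 m * choose n m * ∑ N (λ k → choose n k * choose m k)
        ≡⟨ *-distribˡ-∑ N (legendre3 m * choose n m) (λ k → choose n k * choose m k) ⟩
      ∑ N (λ k → legendre3 m * choose n m * (choose n k * choose m k))
        ≡⟨ ∑-cong N (λ k _ → regroup (legendre3 m) (legendre3 (m ℕ.+ 0)) (choose n m) (choose n k) (choose m k)
                                     (cong legendre3 (sym (ℕP.+-identityʳ m)))) ⟩
      ∑ N (λ k → term k m)
        ∎
      where
        regroup : ∀ x x′ b c d → x ≡ x′ → x * b * (c * d) ≡ c * (x′ * b * d)
        regroup x _ b c d refl = assoc x b c d
          where
            assoc : ∀ x b c d → x * b * (c * d) ≡ c * (x * b * d)
            assoc = solve-∀
    antisymmetric : ∀ k → k ℕ.≤ n → f (n ℕ.∸ k) ≡ - f k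
    antisymmetric k k≤n = begin
      choose n j * (choose n j * negOnePow (n ℕ.+ j) * legendre3 (2 ℕ.* (n ℕ.+ j)))
        ≡⟨ cong₃ same-choose same-sign (legendre3-antisym (2 ℕ.* (n ℕ.+ k)) (2 ℕ.* (n ℕ.+ j)) 3∣sum) ⟩
      choose n k * (choose n k * negOnePow (n ℕ.+ k) * - legendre3 (2 ℕ.* (n ℕ.+ k)))
        ≡⟨ negate (choose n k) (negOnePow (n ℕ.+ k)) (legendre3 (2 ℕ.* (n ℕ.+ k))) ⟩
      - f k
        ∎
      where
        sign-arith : ∀ n j k → 2 ℕ.* k ℕ.+ (n ℕ.+ j) ≡ j ℕ.+ k ℕ.+ (n ℕ.+ k)
        sign-arith = ℕ-Solver.solve-∀
        legendre-arith : ∀ n j k → 2 ℕ.* (n ℕ.+ k) ℕ.+ 2 ℕ.* (n ℕ.+ j) ≡ 2 ℕ.* (n ℕ.+ n ℕ.+ (j ℕ.+ k))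
        legendre-arith = ℕ-Solver.solve-∀
        triple : ∀ n → 2 ℕ.* (n ℕ.+ n ℕ.+ n) ≡ 2 ℕ.* n ℕ.* 3
        triple = ℕ-Solver.solve-∀
        j = n ℕ.∸ k
        j+k≡n : j ℕ.+ k ≡ n
        j+k≡n = ℕP.m∸n+n≡m k≤n
        same-choose : choose n j ≡ choose n k
        same-choose = cong +_ (sym (nCk≡nC[n∸k] k≤n))
        same-sign : negOnePow (n ℕ.+ j) ≡ negOnePow (n ℕ.+ k)
        same-sign = begin
          negOnePow (n ℕ.+ j)                      ≡⟨ negOnePow-2*+ k (n ℕ.+ j) ⟨
          negOnePow (2 ℕ.* k ℕ.+ (n ℕ.+ j))        ≡⟨ cong negOnePow (trans (sign-arith n j k) (cong (ℕ._+ (n ℕ.+ k)) j+k≡n)) ⟩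
          negOnePow (2 ℕ.* q ℕ.+ (n ℕ.+ k))        ≡⟨ negOnePow-2*+ q (n ℕ.+ k) ⟩
          negOnePow (n ℕ.+ k)                      ∎
        3∣sum : 3 ∣ 2 ℕ.* (n ℕ.+ k) ℕ.+ 2 ℕ.* (n ℕ.+ j)
        3∣sum = divides (2 ℕ.* n) (begin
          2 ℕ.* (n ℕ.+ k) ℕ.+ 2 ℕ.* (n ℕ.+ j)    ≡⟨ legendre-arith n j k ⟩
          2 ℕ.* (n ℕ.+ n ℕ.+ (j ℕ.+ k))          ≡⟨ cong (λ i → 2 ℕ.* (n ℕ.+ n ℕ.+ i)) j+k≡n ⟩
          2 ℕ.* (n ℕ.+ n ℕ.+ n)                  ≡⟨ triple n ⟩
          2 ℕ.* n ℕ.* 3                          ∎)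
        negate : ∀ c e x → c * (c * e * - x) ≡ - (c * (c * e * x))
        negate = solve-∀
        cong₃ : ∀ {c c′ e e′ x x′} → c ≡ c′ → e ≡ e′ → x ≡ x′ → c * (c * e * x) ≡ c′ * (c′ * e′ * x′)
        cong₃ refl refl refl = refl

∏ : ℕ → (ℕ → ℤ) → ℤ
∏ zero    f = + 1
∏ (suc k) f = ∏ k f * f k

∏-sub-congruence : ∀ x (f : ℕ → ℤ) k → Σ ℤ λ w → ∏ k f ≡ ∏ k (λ j → f j - x) + x * w
∏-sub-congruence x f zero = + 0 , sym (cong (_+_ (+ 1)) (ℤP.*-zeroʳ x))
∏-sub-congruence x f (suc k) with ∏-sub-congruence x f k
... | w , ∏f≡ = w * f k + ∏ k (λ j → f j - x) , (begin
  ∏ k f * f k                                   ≡⟨ cong (_* f k) ∏f≡ ⟩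
  (∏ k (λ j → f j - x) + x * w) * f k           ≡⟨ step (∏ k (λ j → f j - x)) x w (f k) ⟩
  ∏ k (λ j → f j - x) * (f k - x) + x * (w * f k + ∏ k (λ j → f j - x)) ∎)
  where
    step : ∀ v x w a → (v + x * w) * a ≡ v * (a - x) + x * (w * a + v)
    step = solve-∀

oddSquare : ℕ → ℤ
oddSquare j = + suc (2 ℕ.* j) * + suc (2 ℕ.* j)

evenSquares : ℕ → ℕ
evenSquares zero    = 1
evenSquares (suc k) = evenSquares k ℕ.* (2 ℕ.* suc k ℕ.* (2 ℕ.* suc k))

evenSquares-nonZero : ∀ k → ℕ.NonZero (evenSquares k)
evenSquares-nonZero zero    = _
evenSquares-nonZero (suc k) = ℕP.m*n≢0 (evenSquares k) (2 ℕ.* suc k ℕ.* (2 ℕ.* suc k)) {{evenSquares-nonZero k}}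

+-evenSquares-suc : ∀ k → + evenSquares (suc k) ≡ + evenSquares k * (+ 2 * + suc k * (+ 2 * + suc k))
+-evenSquares-suc k = begin
  + (evenSquares k ℕ.* (2 ℕ.* suc k ℕ.* (2 ℕ.* suc k)))     ≡⟨ ℤP.pos-* (evenSquares k) _ ⟩
  + evenSquares k * + (2 ℕ.* suc k ℕ.* (2 ℕ.* suc k))      ≡⟨ cong (+ evenSquares k *_) (ℤP.pos-* (2 ℕ.* suc k) (2 ℕ.* suc k)) ⟩
  + evenSquares k * (+ (2 ℕ.* suc k) * + (2 ℕ.* suc k))    ≡⟨ cong (λ x → + evenSquares k * (x * x)) (ℤP.pos-* 2 (suc k)) ⟩
  + evenSquares k * (+ 2 * + suc k * (+ 2 * + suc k))      ∎

centralChoose²-evenSquares : ∀ k →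
  choose (2 ℕ.* k) k * choose (2 ℕ.* k) k * + evenSquares k ≡ + (16 ^ k) * ∏ k oddSquare
centralChoose²-evenSquares zero    = refl
centralChoose²-evenSquares (suc k) = begin
  c′ * c′ * + evenSquares (suc k)                        ≡⟨ cong (c′ * c′ *_) (+-evenSquares-suc k) ⟩
  c′ * c′ * (D * (+ 2 * K * (+ 2 * K)))                  ≡⟨ regroup c′ K D ⟩
  + 4 * (K * c′) * (K * c′) * D                          ≡⟨ cong (λ x → + 4 * x * x * D) (centralChoose-suc k) ⟩
  + 4 * (+ 2 * S * c) * (+ 2 * S * c) * D                ≡⟨ collect S c D ⟩
  + 16 * (c * c * D) * (S * S)                           ≡⟨ cong (λ x → + 16 * x * (S * S)) (centralChoose²-evenSquares k) ⟩
  + 16 * (+ (16 ^ k) * ∏ k oddSquare) * (S * S)          ≡⟨ reassoc (+ (16 ^ k)) (∏ k oddSquare) (S * S) ⟩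
  + 16 * + (16 ^ k) * (∏ k oddSquare * (S * S))          ≡⟨ cong (_* ∏ (suc k) oddSquare) (ℤP.pos-* 16 (16 ^ k)) ⟨
  + (16 ^ suc k) * ∏ (suc k) oddSquare                   ∎
  where
    c = choose (2 ℕ.* k) k
    c′ = choose (2 ℕ.* suc k) (suc k)
    K = + suc k
    S = + suc (2 ℕ.* k)
    D = + evenSquares k
    regroup : ∀ c K D → c * c * (D * (+ 2 * K * (+ 2 * K))) ≡ + 4 * (K * c) * (K * c) * D
    regroup = solve-∀
    collect : ∀ S c D → + 4 * (+ 2 * S * c) * (+ 2 * S * c) * D ≡ + 16 * (c * c * D) * (S * S)
    collect = solve-∀
    reassoc : ∀ x u s → + 16 * (x * u) * s ≡ + 16 * x * (u * s)
    reassoc = solve-∀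

+-odd : ∀ k → + suc (2 ℕ.* k) ≡ + 1 + + 2 * + k
+-odd k = trans (ℤP.pos-+ 1 (2 ℕ.* k)) (cong (_+_ (+ 1)) (ℤP.pos-* 2 k))

choose-product-evenSquares : ∀ n k →
  + evenSquares k * (choose n k * choose (n ℕ.+ k) k) ≡ negOnePow k * ∏ k (λ j → oddSquare j - oddSquare n)
choose-product-evenSquares n zero    = refl
choose-product-evenSquares n (suc k) = begin
  + evenSquares (suc k) * (choose n (suc k) * choose (n ℕ.+ suc k) (suc k))
    ≡⟨ cong₂ (λ x i → x * (choose n (suc k) * choose i (suc k))) (+-evenSquares-suc k) (ℕP.+-suc n k) ⟩
  D * (+ 2 * K * (+ 2 * K)) * (choose n (suc k) * choose (suc (n ℕ.+ k)) (suc k))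
    ≡⟨ regroup K D (choose n (suc k)) (choose (suc (n ℕ.+ k)) (suc k)) ⟩
  + 4 * D * (K * choose n (suc k)) * (K * choose (suc (n ℕ.+ k)) (suc k))
    ≡⟨ cong₂ (λ x y → + 4 * D * x * y) (choose-suc-ratio n k) (choose-absorption (n ℕ.+ k) k) ⟩
  + 4 * D * ((+ n - + k) * choose n k) * (+ suc (n ℕ.+ k) * choose (n ℕ.+ k) k)
    ≡⟨ collect D (+ n - + k) (+ suc (n ℕ.+ k)) (choose n k) (choose (n ℕ.+ k) k) ⟩
  + 4 * (+ n - + k) * + suc (n ℕ.+ k) * (D * (choose n k * choose (n ℕ.+ k) k))
    ≡⟨ cong₂ (λ x y → + 4 * (+ n - + k) * x * y) +suc[n+k] (choose-product-evenSquares n k) ⟩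
  + 4 * (+ n - + k) * (+ 1 + (+ n + + k)) * (E * V)
    ≡⟨ difference-of-squares (+ n) (+ k) E V ⟩
  - E * (V * ((+ 1 + + 2 * + k) * (+ 1 + + 2 * + k) - (+ 1 + + 2 * + n) * (+ 1 + + 2 * + n)))
    ≡⟨ cong₂ (λ x y → - E * (V * (x * x - y * y))) (+-odd k) (+-odd n) ⟨
  negOnePow (suc k) * ∏ (suc k) (λ j → oddSquare j - oddSquare n)
    ∎
  where
    K = + suc k
    D = + evenSquares k
    E = negOnePow k
    V = ∏ k (λ j → oddSquare j - oddSquare n)
    +suc[n+k] : + suc (n ℕ.+ k) ≡ + 1 + (+ n + + k)
    +suc[n+k] = trans (ℤP.pos-+ 1 (n ℕ.+ k)) (cong (_+_ (+ 1)) (ℤP.pos-+ n k))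
    regroup : ∀ K D x y → D * (+ 2 * K * (+ 2 * K)) * (x * y) ≡ + 4 * D * (K * x) * (K * y)
    regroup = solve-∀
    collect : ∀ D a c x y → + 4 * D * (a * x) * (c * y) ≡ + 4 * a * c * (D * (x * y))
    collect = solve-∀
    difference-of-squares : ∀ N K E V →
      + 4 * (N - K) * (+ 1 + (N + K)) * (E * V) ≡ - E * (V * ((+ 1 + + 2 * K) * (+ 1 + + 2 * K) - (+ 1 + + 2 * N) * (+ 1 + + 2 * N)))
    difference-of-squares = solve-∀

fromℤ : ℤ → ℚ
fromℤ a = a / 1

toℚᵘ-/ : ∀ a d .{{_ : NonZero d}} → toℚᵘ (a / d) ≃ a ℚᵘ./ d
toℚᵘ-/ a (suc d) = ℚP.toℚᵘ-fromℚᵘ (mkℚᵘ a d)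

/-≡ : ∀ a c d e .{{_ : NonZero d}} .{{_ : NonZero e}} → a ℤ.* + e ≡ c ℤ.* + d → a / d ≡ c / e
/-≡ a c d@(suc _) e@(suc _) ae≡cd =
  ℚP.toℚᵘ-injective (ℚᵘP.≃-trans (toℚᵘ-/ a d) (ℚᵘP.≃-trans (*≡* ae≡cd) (ℚᵘP.≃-sym (toℚᵘ-/ c e))))

/-+ : ∀ a c d e .{{_ : NonZero d}} .{{_ : NonZero e}} →
      a / d ℚ.+ c / e ≡ ((a ℤ.* + e ℤ.+ c ℤ.* + d) / (d ℕ.* e)) {{ℕP.m*n≢0 d e}}
/-+ a c d@(suc _) e@(suc _) = ℚP.toℚᵘ-injective (begin≃
  toℚᵘ (a / d ℚ.+ c / e)                       ≈⟨ ℚP.toℚᵘ-homo-+ (a / d) (c / e) ⟩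
  toℚᵘ (a / d) ℚᵘ.+ toℚᵘ (c / e)              ≈⟨ ℚᵘP.+-cong (toℚᵘ-/ a d) (toℚᵘ-/ c e) ⟩
  (a ℤ.* + e ℤ.+ c ℤ.* + d) ℚᵘ./ (d ℕ.* e)    ≈⟨ toℚᵘ-/ (a ℤ.* + e ℤ.+ c ℤ.* + d) (d ℕ.* e) ⟨
  toℚᵘ ((a ℤ.* + e ℤ.+ c ℤ.* + d) / (d ℕ.* e)) ∎≃)
  where open ℚᵘP.≃-Reasoning renaming (begin_ to begin≃_; _∎ to _∎≃)

fromℤ-+ : ∀ a c → fromℤ a ℚ.+ fromℤ c ≡ fromℤ (a ℤ.+ c)
fromℤ-+ a c = trans (/-+ a c 1 1) (ℚP./-cong (cong₂ ℤ._+_ (ℤP.*-identityʳ a) (ℤP.*-identityʳ c)) refl)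

/-split : ∀ x y z d .{{_ : NonZero d}} → (x ℤ.* + d ℤ.+ y ℤ.* z) / d ≡ fromℤ x ℚ.+ fromℤ y ℚ.* (z / d)
/-split x y z d@(suc d-1) = ℚP.toℚᵘ-injective (begin≃
  toℚᵘ ((x ℤ.* + d ℤ.+ y ℤ.* z) / d)                      ≈⟨ toℚᵘ-/ (x ℤ.* + d ℤ.+ y ℤ.* z) d ⟩
  (x ℤ.* + d ℤ.+ y ℤ.* z) ℚᵘ./ d                          ≈⟨ *≡* cross-multiplied ⟩
  x ℚᵘ./ 1 ℚᵘ.+ y ℚᵘ./ 1 ℚᵘ.* (z ℚᵘ./ d)                  ≈⟨ ℚᵘP.+-cong (toℚᵘ-/ x 1) (ℚᵘP.*-cong (toℚᵘ-/ y 1) (toℚᵘ-/ z d)) ⟨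
  toℚᵘ (fromℤ x) ℚᵘ.+ toℚᵘ (fromℤ y) ℚᵘ.* toℚᵘ (z / d)   ≈⟨ ℚᵘP.+-congʳ (toℚᵘ (fromℤ x)) (ℚP.toℚᵘ-homo-* (fromℤ y) (z / d)) ⟨
  toℚᵘ (fromℤ x) ℚᵘ.+ toℚᵘ (fromℤ y ℚ.* (z / d))          ≈⟨ ℚP.toℚᵘ-homo-+ (fromℤ x) (fromℤ y ℚ.* (z / d)) ⟨
  toℚᵘ (fromℤ x ℚ.+ fromℤ y ℚ.* (z / d))                  ∎≃)
  where
    open ℚᵘP.≃-Reasoning renaming (begin_ to begin≃_; _∎ to _∎≃)
    rearrange : ∀ x y z D → (x ℤ.* D ℤ.+ y ℤ.* z) ℤ.* D ≡ (x ℤ.* D ℤ.+ y ℤ.* z ℤ.* + 1) ℤ.* D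
    rearrange = solve-∀
    cross-multiplied : (x ℤ.* + d ℤ.+ y ℤ.* z) ℤ.* + (1 ℕ.* (1 ℕ.* d)) ≡ (x ℤ.* + (1 ℕ.* d) ℤ.+ y ℤ.* z ℤ.* + 1) ℤ.* + d
    cross-multiplied rewrite ℕP.+-identityʳ d-1 | ℕP.+-identityʳ d-1 = rearrange x y z (+ d)

↧ₙ-/-∣ : ∀ a d .{{_ : NonZero d}} → ℚ.denominatorℕ (a / d) ∣ d
↧ₙ-/-∣ a d = divides g (ℤP.+-injective (begin
  + d                                      ≡⟨ ℚP.↧-/ a d ⟨
  + ℚ.denominatorℕ (a / d) ℤ.* + g         ≡⟨ ℤP.*-comm (+ ℚ.denominatorℕ (a / d)) (+ g) ⟩
  + g ℤ.* + ℚ.denominatorℕ (a / d)         ≡⟨ ℤP.pos-* g (ℚ.denominatorℕ (a / d)) ⟨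
  + (g ℕ.* ℚ.denominatorℕ (a / d))         ∎))
  where
    g = ℕGCD.gcd ℤ.∣ a ∣ d

record IntegralAt (p : ℕ) (x : ℚ) : Set where
  constructor integralAt
  field
    num        : ℤ
    den        : ℕ
    .{{den≢0}} : NonZero den
    p∤den      : ¬ p ∣ den
    x≡num/den  : x ≡ num / den

integralAt-+ : ∀ {p x y} → Prime p → IntegralAt p x → IntegralAt p y → IntegralAt p (x ℚ.+ y)
integralAt-+ p-prime (integralAt a d p∤d x≡) (integralAt c e p∤e y≡) =
  integralAt (a ℤ.* + e ℤ.+ c ℤ.* + d) (d ℕ.* e) {{ℕP.m*n≢0 d e}}
    (λ p∣de → [ p∤d , p∤e ] (euclidsLemma d e p-prime p∣de))
    (trans (cong₂ ℚ._+_ x≡ y≡) (/-+ a c d e))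

integralAt-sumTo : ∀ {p} N (f : ℕ → ℚ) → Prime p → (∀ k → k ℕ.< N → IntegralAt p (f k)) → IntegralAt p (sumTo N f)
integralAt-sumTo zero    f p-prime _  =
  integralAt (+ 0) 1 (λ p∣1 → ℕ.nonTrivial⇒≢1 {{prime⇒nonTrivial p-prime}} (∣1⇒≡1 p∣1)) refl
integralAt-sumTo (suc N) f p-prime fᵢ =
  integralAt-+ p-prime (integralAt-sumTo N f p-prime (λ k k<N → fᵢ k (ℕP.m<n⇒m<1+n k<N))) (fᵢ N ℕP.≤-refl)

integralAt⇒coprime : ∀ {p x} → Prime p → IntegralAt p x → Coprime (ℚ.denominatorℕ x) p
integralAt⇒coprime p-prime (integralAt a d p∤d refl) {i} (i∣den , i∣p) with prime⇒irreducible p-prime i∣p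
... | inj₁ i≡1 = i≡1
... | inj₂ refl = ⊥-elim (p∤d (∣-trans i∣den (↧ₙ-/-∣ a d)))

sumTo-split : ∀ N (f r : ℕ → ℚ) (g : ℕ → ℤ) c → (∀ k → f k ≡ fromℤ (g k) ℚ.+ c ℚ.* r k) →
              sumTo N f ≡ fromℤ (∑ N g) ℚ.+ c ℚ.* sumTo N r
sumTo-split zero    f r g c _     = sym (trans (ℚP.+-identityˡ (c ℚ.* 0ℚ)) (ℚP.*-zeroʳ c))
sumTo-split (suc N) f r g c f≡ = begin
  sumTo N f ℚ.+ f N
    ≡⟨ cong₂ ℚ._+_ (sumTo-split N f r g c f≡) (f≡ N) ⟩
  (fromℤ (∑ N g) ℚ.+ c ℚ.* sumTo N r) ℚ.+ (fromℤ (g N) ℚ.+ c ℚ.* r N)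
    ≡⟨ interchange (fromℤ (∑ N g)) (fromℤ (g N)) c (sumTo N r) (r N) ⟩
  (fromℤ (∑ N g) ℚ.+ fromℤ (g N)) ℚ.+ c ℚ.* (sumTo N r ℚ.+ r N)
    ≡⟨ cong (ℚ._+ c ℚ.* sumTo (suc N) r) (fromℤ-+ (∑ N g) (g N)) ⟩
  fromℤ (∑ (suc N) g) ℚ.+ c ℚ.* sumTo (suc N) r
    ∎
  where
    open +-*-Solver
    interchange : ∀ a b c y z → (a ℚ.+ c ℚ.* y) ℚ.+ (b ℚ.+ c ℚ.* z) ≡ (a ℚ.+ b) ℚ.+ c ℚ.* (y ℚ.+ z)
    interchange = solve 5 (λ a b c y z → (a :+ c :* y) :+ (b :+ c :* z) := (a :+ b) :+ c :* (y :+ z)) refl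

-- The p²-part of the k-th summand, with p = 2n + 1.
remainderNumerator : ℕ → ℕ → ℤ
remainderNumerator n k = legendre3 k * negOnePow k * proj₁ (∏-sub-congruence (oddSquare n) oddSquare k)

remainder : ℕ → ℕ → ℚ
remainder n k = (remainderNumerator n k / evenSquares k) {{evenSquares-nonZero k}}

summand-split : ∀ n k → summand k ≡
  fromℤ (legendre3 k * (choose n k * choose (n ℕ.+ k) k)) ℚ.+ fromℤ (oddSquare n) ℚ.* remainder n k
summand-split n k = begin
  summand k
    ≡⟨ /-≡ (χ * ε * c * c) (χ * Cₖ * + D + P * ζ) (16 ^ k) D {{16^k-nonZero k}} {{evenSquares-nonZero k}} cross-multiplied ⟩
  ((χ * Cₖ * + D + P * ζ) / D) {{evenSquares-nonZero k}}
    ≡⟨ /-split (χ * Cₖ) P ζ D {{evenSquares-nonZero k}} ⟩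
  fromℤ (χ * Cₖ) ℚ.+ fromℤ P ℚ.* remainder n k
    ∎
  where
    χ = legendre3 k
    ε = negOnePow k
    c = choose (2 ℕ.* k) k
    Cₖ = choose n k * choose (n ℕ.+ k) k
    D = evenSquares k
    P = oddSquare n
    U = ∏ k oddSquare
    V = ∏ k (λ j → oddSquare j - P)
    w = proj₁ (∏-sub-congruence P oddSquare k)
    ζ = χ * ε * w
    regroup : ∀ χ ε c D → χ * ε * c * c * D ≡ χ * ε * (c * c * D)
    regroup = solve-∀
    expand : ∀ χ ε S V P w → χ * ε * (S * (V + P * w)) ≡ (χ * (ε * V) + P * (χ * ε * w)) * S
    expand = solve-∀
    reorder : ∀ χ D C P z S → (χ * (D * C) + P * z) * S ≡ (χ * C * D + P * z) * S
    reorder = solve-∀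
    cross-multiplied : χ * ε * c * c * + D ≡ (χ * Cₖ * + D + P * ζ) * + (16 ^ k)
    cross-multiplied = begin
      χ * ε * c * c * + D                              ≡⟨ regroup χ ε c (+ D) ⟩
      χ * ε * (c * c * + D)                            ≡⟨ cong (χ * ε *_) (centralChoose²-evenSquares k) ⟩
      χ * ε * (+ (16 ^ k) * U)                         ≡⟨ cong (λ x → χ * ε * (+ (16 ^ k) * x)) (proj₂ (∏-sub-congruence P oddSquare k)) ⟩
      χ * ε * (+ (16 ^ k) * (V + P * w))               ≡⟨ expand χ ε (+ (16 ^ k)) V P w ⟩
      (χ * (ε * V) + P * ζ) * + (16 ^ k)               ≡⟨ cong (λ x → (χ * x + P * ζ) * + (16 ^ k)) (choose-product-evenSquares n k) ⟨
      (χ * (+ D * Cₖ) + P * ζ) * + (16 ^ k)            ≡⟨ reorder χ (+ D) Cₖ P ζ (+ (16 ^ k)) ⟩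
      (χ * Cₖ * + D + P * ζ) * + (16 ^ k)              ∎

∤-between : ∀ {p m} → 0 < m → m < p → ¬ p ∣ m
∤-between {m = suc _} _ m<p p∣m = ℕP.<⇒≱ m<p (∣⇒≤ p∣m)

∤-evenSquares : ∀ {p} k → Prime p → 2 < p → k < p → ¬ p ∣ evenSquares k
∤-evenSquares zero    p-prime 2<p _ p∣1 = ∤-between ℕ.z<s (ℕP.<-trans (ℕ.s≤s ℕ.z<s) 2<p) p∣1
∤-evenSquares (suc k) p-prime 2<p k<p p∣E =
  [ ∤-evenSquares k p-prime 2<p (ℕP.<-trans (ℕP.n<1+n k) k<p) , [ ∤-double , ∤-double ] ∘ euclidsLemma _ _ p-prime ]
    (euclidsLemma (evenSquares k) _ p-prime p∣E)
  where
    ∤-double : ¬ _ ∣ 2 ℕ.* suc k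
    ∤-double p∣2k = [ ∤-between ℕ.z<s 2<p , ∤-between ℕ.z<s k<p ] (euclidsLemma 2 (suc k) p-prime p∣2k)

remainder-integralAt : ∀ {p} n k → Prime p → 2 < p → k < p → IntegralAt p (remainder n k)
remainder-integralAt n k p-prime 2<p k<p =
  integralAt (remainderNumerator n k) (evenSquares k) {{evenSquares-nonZero k}} (∤-evenSquares k p-prime 2<p k<p) refl

corollary1p3 : (p : ℕ) → Prime p → p % 4 ≡ 1 →
    ≡0-mod-in-ℤ₍ p ₎ (sumTo p summand) (p ^ 2)
corollary1p3 p p-prime p%4≡1 =
  sumTo p (remainder n) ,
  integralAt⇒coprime p-prime (integralAt-sumTo p (remainder n) p-prime (λ k k<p → remainder-integralAt n k p-prime 2<p k<p)) ,
  (begin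
    sumTo p summand
      ≡⟨ sumTo-split p summand (remainder n) _ (fromℤ (oddSquare n)) (summand-split n) ⟩
    fromℤ (∑ p (λ k → legendre3 k * (choose n k * choose (n ℕ.+ k) k))) ℚ.+ fromℤ (oddSquare n) ℚ.* sumTo p (remainder n)
      ≡⟨ cong₂ (λ s P → fromℤ s ℚ.+ fromℤ P ℚ.* sumTo p (remainder n)) (legendre-choose-sum≡0 q n<p) oddSquare≡p² ⟩
    0ℚ ℚ.+ (+ (p ^ 2) / 1) ℚ.* sumTo p (remainder n)
      ≡⟨ ℚP.+-identityˡ _ ⟩
    (+ (p ^ 2) / 1) ℚ.* sumTo p (remainder n)
      ∎)
  where
    q = p ℕ./ 4
    n = 2 ℕ.* q
    p≡2n+1 : p ≡ suc (2 ℕ.* n)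
    p≡2n+1 = trans (m≡m%n+[m/n]*n p 4) (trans (cong (ℕ._+ q ℕ.* 4) p%4≡1) (arith q))
      where
        arith : ∀ q → 1 ℕ.+ q ℕ.* 4 ≡ suc (2 ℕ.* (2 ℕ.* q))
        arith = ℕ-Solver.solve-∀
    n<p : n < p
    n<p = subst (n <_) (sym p≡2n+1) (ℕ.s≤s (ℕP.m≤n*m n 2))
    2<p : 2 < p
    2<p = ℕP.≤∧≢⇒< (ℕ.nonTrivial⇒n>1 p {{prime⇒nonTrivial p-prime}}) (λ { refl → case p%4≡1 of λ () })
    oddSquare≡p² : oddSquare n ≡ + (p ^ 2)
    oddSquare≡p² = begin
      + suc (2 ℕ.* n) * + suc (2 ℕ.* n)     ≡⟨ ℤP.pos-* (suc (2 ℕ.* n)) (suc (2 ℕ.* n)) ⟨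
      + (suc (2 ℕ.* n) ℕ.* suc (2 ℕ.* n))   ≡⟨ cong (λ m → + (m ℕ.* m)) p≡2n+1 ⟨
      + (p ℕ.* p)                           ≡⟨ cong (λ m → + (p ℕ.* m)) (ℕP.*-identityʳ p) ⟨
      + (p ^ 2)                             ∎
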